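{- Let $n$ be a positive integer, $k=\lceil\log_3 n\rceil$, and let $m$ be an integer with $n\le m<3^k<3n$. Suppose that $m=2^r3^s$ with $r,s$ positive integers. Then there exist integers $1\le a<b\le n$ such that $b^3+b\equiv a^3+a\pmod{m}$.
   Context: $\lceil x\rceil$ denotes the smallest integer no less than $x$. -}

module Defs where

open import Data.Nat using (ℕ; zero; suc; _^_; _≤?_)
open import Data.Integer using (ℤ; _-_)
open import Data.Integer.Divisibility using (_∣_)
open import Relation.Nullary using (yes; no)

_≡_[mod_] : ℤ → ℤ → ℤ → Set
x ≡ y [mod m ] = m ∣ (x - y)

-- ⌈log₃ n⌉ : the least natural number k with n ≤ 3 ^ k.
-- searchLog3 fuel k n returns the least j ≥ k with n ≤ 3^j, provided one
-- exists within 'fuel' steps; fuel n suffices for k = 0 since n ≤ 3^n.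
searchLog3 : ℕ → ℕ → ℕ → ℕ
searchLog3 zero    k n = k
searchLog3 (suc f) k n with n ≤? 3 ^ k
... | yes _ = k
... | no  _ = searchLog3 f (suc k) n

⌈log₃_⌉ : ℕ → ℕ
⌈log₃ n ⌉ = searchLog3 n 0 n

{-# OPTIONS --safe #-}
-- With b = 1 + h one has b³ + b − 2 = h (h² + 3h + 4) and h² + 3h + 4 is even, so
-- b³ + b ≡ 1³ + 1 (mod 2h); similarly 1 + 4w collides with 1 modulo 16w.  Writing
-- m = 2^r 3^s, take h = 3^s, 2·3^s for r = 1, 2 and w = 2^(r−4) 3^s for r ≥ 4.  For
-- r = 3, 3^s ≡ 1 or 3 (mod 8) and b = 3^s + 1 resp. 3^s + 2 collides with a = 1
-- resp. 2 modulo 8·3^s.  The needed b ≤ n always comes from m < 3^K < 3n: as 3^K is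
-- a power of 3, 3^a < 3^K forces 3^(a+1) ≤ 3^K, hence 3^a < n.
module Submission where

open import Defs
open import Data.Nat using (ℕ; zero; suc; _+_; _*_; _^_; _∸_; _≤_; _<_; z≤n; s≤s; NonZero)
open import Data.Nat.Properties
open import Data.Nat.Tactic.RingSolver using (solve-∀)
import Data.Nat.Divisibility as ℕ
open import Data.Integer using (+_; _-_; _⊖_) renaming (∣_∣ to ∣_∣ℤ)
import Data.Integer.Properties as ℤ
open import Data.Product using (∃-syntax; _×_; _,_)
open import Data.Sum using (_⊎_; inj₁; inj₂)
open import Relation.Binary.PropositionalEquality
  using (_≡_; refl; sym; cong; subst; module ≡-Reasoning)

CubeCollision : ℕ → ℕ → Set
CubeCollision n m = ∃[ a ] ∃[ b ] (1 ≤ a × a < b × b ≤ n ×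
  (+ (b ^ 3 + b)) ≡ (+ (a ^ 3 + a)) [mod (+ m) ])

≡[mod]-of-≡+* : ∀ {x} y m c → x ≡ y + m * c → (+ x) ≡ (+ y) [mod (+ m) ]
≡[mod]-of-≡+* {x} y m c x≡y+mc = ℕ.divides c (begin
  ∣ + x - + y ∣ℤ  ≡⟨ cong ∣_∣ℤ (ℤ.m-n≡m⊖n x y) ⟩
  ∣ x ⊖ y ∣ℤ      ≡⟨ cong ∣_∣ℤ (ℤ.⊖-≥ y≤x) ⟩
  x ∸ y           ≡⟨ cong (_∸ y) x≡y+mc ⟩
  y + m * c ∸ y   ≡⟨ m+n∸m≡n y (m * c) ⟩
  m * c           ≡⟨ *-comm m c ⟩
  c * m           ∎)
  where
  open ≡-Reasoning
  y≤x : y ≤ x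
  y≤x = subst (y ≤_) (sym x≡y+mc) (m≤m+n y (m * c))

even-or-odd : ∀ h → ∃[ u ] (h ≡ 2 * u ⊎ h ≡ 1 + 2 * u)
even-or-odd zero = 0 , inj₁ refl
even-or-odd (suc zero) = 0 , inj₂ refl
even-or-odd (suc (suc h)) with even-or-odd h
... | u , inj₁ refl = suc u , inj₁ (cong suc (sym (+-suc u (u + 0))))
... | u , inj₂ refl = suc u , inj₂ (cong (λ k → 2 + k) (sym (+-suc u (u + 0))))

[1+h]³+[1+h]≡2+2h*_ : ∀ h → ∃[ q ] (suc h ^ 3 + suc h ≡ 2 + 2 * h * q)
[1+h]³+[1+h]≡2+2h*_ h with even-or-odd h
... | u , inj₁ refl = u * (2 * u + 3) + 2 , identity u
  where
  -- b ^ 3 appears unfolded as b * (b * (b * 1)): solve-∀ does not reflect _^_.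
  identity : ∀ u → (1 + 2 * u) * ((1 + 2 * u) * ((1 + 2 * u) * 1)) + (1 + 2 * u)
                 ≡ 2 + 2 * (2 * u) * (u * (2 * u + 3) + 2)
  identity = solve-∀
... | u , inj₂ refl = (2 * u + 1) * (u + 2) + 2 , identity u
  where
  identity : ∀ u → (2 + 2 * u) * ((2 + 2 * u) * ((2 + 2 * u) * 1)) + (2 + 2 * u)
                 ≡ 2 + 2 * (1 + 2 * u) * ((2 * u + 1) * (u + 2) + 2)
  identity = solve-∀

3^s≡1∨3-mod-8 : ∀ s → ∃[ u ] (3 ^ s ≡ 8 * u + 1 ⊎ 3 ^ s ≡ 8 * u + 3)
3^s≡1∨3-mod-8 zero = 0 , inj₁ refl
3^s≡1∨3-mod-8 (suc s) with 3^s≡1∨3-mod-8 s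
... | u , inj₁ 3^s≡8u+1 = 3 * u , inj₂ (begin
  3 * 3 ^ s         ≡⟨ cong (3 *_) 3^s≡8u+1 ⟩
  3 * (8 * u + 1)   ≡⟨ identity u ⟩
  8 * (3 * u) + 3   ∎)
  where
  open ≡-Reasoning
  identity : ∀ u → 3 * (8 * u + 1) ≡ 8 * (3 * u) + 3
  identity = solve-∀
... | u , inj₂ 3^s≡8u+3 = 3 * u + 1 , inj₁ (begin
  3 * 3 ^ s             ≡⟨ cong (3 *_) 3^s≡8u+3 ⟩
  3 * (8 * u + 3)       ≡⟨ identity u ⟩
  8 * (3 * u + 1) + 1   ∎)
  where
  open ≡-Reasoning
  identity : ∀ u → 3 * (8 * u + 3) ≡ 8 * (3 * u + 1) + 1
  identity = solve-∀

collision-mod-2* : ∀ {n h} → 1 ≤ h → h < n → CubeCollision n (2 * h)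
collision-mod-2* {h = h} 1≤h h<n with [1+h]³+[1+h]≡2+2h*_ h
... | q , eq = 1 , suc h , ≤-refl , s≤s 1≤h , h<n , ≡[mod]-of-≡+* 2 (2 * h) q eq

collision-mod-16* : ∀ {n w} → 1 ≤ w → 4 * w < n → CubeCollision n (16 * w)
collision-mod-16* {w = w} 1≤w 4w<n =
  1 , 1 + 4 * w , ≤-refl , s≤s (≤-trans 1≤w (m≤n*m w 4)) , 4w<n ,
  ≡[mod]-of-≡+* 2 (16 * w) (4 * w * w + 3 * w + 1) (identity w)
  where
  identity : ∀ w → (1 + 4 * w) * ((1 + 4 * w) * ((1 + 4 * w) * 1)) + (1 + 4 * w)
               ≡ 2 + 16 * w * (4 * w * w + 3 * w + 1)
  identity = solve-∀

collision-mod-8*3^ : ∀ {n} s → 3 ^ s + 2 ≤ n → CubeCollision n (8 * 3 ^ s)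
collision-mod-8*3^ {n} s 3^s+2≤n with 3^s≡1∨3-mod-8 s
... | u , inj₁ 3^s≡8u+1 rewrite 3^s≡8u+1 =
  1 , 8 * u + 2 , ≤-refl , m≤n+m 2 (8 * u) ,
  ≤-trans (+-monoʳ-≤ (8 * u) (n≤1+n 2)) (subst (_≤ n) (+-assoc (8 * u) 1 2) 3^s+2≤n) ,
  ≡[mod]-of-≡+* 2 (8 * (8 * u + 1)) (8 * u * u + 5 * u + 1) (identity u)
  where
  identity : ∀ u → (8 * u + 2) * ((8 * u + 2) * ((8 * u + 2) * 1)) + (8 * u + 2)
               ≡ 2 + 8 * (8 * u + 1) * (8 * u * u + 5 * u + 1)
  identity = solve-∀
... | u , inj₂ 3^s≡8u+3 rewrite 3^s≡8u+3 =
  2 , 8 * u + 5 , s≤s z≤n , ≤-trans (m≤m+n 3 2) (m≤n+m 5 (8 * u)) ,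
  subst (_≤ n) (+-assoc (8 * u) 3 2) 3^s+2≤n ,
  ≡[mod]-of-≡+* 10 (8 * (8 * u + 3)) (8 * u * u + 12 * u + 5) (identity u)
  where
  identity : ∀ u → (8 * u + 5) * ((8 * u + 5) * ((8 * u + 5) * 1)) + (8 * u + 5)
               ≡ 10 + 8 * (8 * u + 3) * (8 * u * u + 12 * u + 5)
  identity = solve-∀

m^a<m^b⇒m^[1+a]≤m^b : ∀ m .{{_ : NonZero m}} a b → m ^ a < m ^ b → m ^ suc a ≤ m ^ b
m^a<m^b⇒m^[1+a]≤m^b m a b m^a<m^b =
  ^-monoʳ-≤ m {suc a} {b} (≰⇒> λ b≤a → <⇒≱ m^a<m^b (^-monoʳ-≤ m {b} {a} b≤a))

3^a<3^K<3n⇒3^a<n : ∀ a K {n} → 3 ^ a < 3 ^ K → 3 ^ K < 3 * n → 3 ^ a < n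
3^a<3^K<3n⇒3^a<n a K {n} 3^a<3^K 3^K<3n =
  *-cancelˡ-< 3 (3 ^ a) n (≤-<-trans (m^a<m^b⇒m^[1+a]≤m^b 3 a K 3^a<3^K) 3^K<3n)

collision-mod-2^r*3^s : ∀ {n} r s K → 1 ≤ r → 2 ^ r * 3 ^ s < 3 ^ K → 3 ^ K < 3 * n →
  CubeCollision n (2 ^ r * 3 ^ s)
collision-mod-2^r*3^s 1 s K _ 2x<3^K 3^K<3n =
  collision-mod-2* 1≤x (3^a<3^K<3n⇒3^a<n s K (≤-<-trans (m≤n*m x 2) 2x<3^K) 3^K<3n)
  where
  x : ℕ
  x = 3 ^ s
  1≤x : 1 ≤ x
  1≤x = m^n>0 3 s
collision-mod-2^r*3^s {n} 2 s K _ 4x<3^K 3^K<3n =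
  subst (CubeCollision n) (sym (*-assoc 2 2 x))
    (collision-mod-2* 1≤2x (<-trans (*-monoˡ-< x (n<1+n 2)) 3x<n))
  where
  x : ℕ
  x = 3 ^ s
  instance
    x≢0 : NonZero x
    x≢0 = m^n≢0 3 s
  1≤2x : 1 ≤ 2 * x
  1≤2x = ≤-trans (m^n>0 3 s) (m≤n*m x 2)
  3x<n : 3 * x < n
  3x<n = 3^a<3^K<3n⇒3^a<n (suc s) K (<-trans (*-monoˡ-< x (n<1+n 3)) 4x<3^K) 3^K<3n
collision-mod-2^r*3^s {n} 3 s K _ 8x<3^K 3^K<3n = collision-mod-8*3^ s x+2≤n
  where
  x : ℕ
  x = 3 ^ s
  instance
    x≢0 : NonZero x
    x≢0 = m^n≢0 3 s
  3<8 : 3 < 8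
  3<8 = s≤s (s≤s (s≤s (s≤s z≤n)))
  3x<n : 3 * x < n
  3x<n = 3^a<3^K<3n⇒3^a<n (suc s) K (<-trans (*-monoˡ-< x 3<8) 8x<3^K) 3^K<3n
  x+2≤n : x + 2 ≤ n
  x+2≤n = ≤-trans (+-monoʳ-≤ x (*-monoʳ-≤ 2 (m^n>0 3 s))) (<⇒≤ 3x<n)
collision-mod-2^r*3^s {n} (suc (suc (suc (suc p)))) s K _ m<3^K 3^K<3n =
  subst (CubeCollision n) (sym (16*-regroup (2 ^ p) (3 ^ s)))
    (collision-mod-16* (*-mono-≤ (m^n>0 2 p) (m^n>0 3 s)) 4w<n)
  where
  w : ℕ
  w = 2 ^ p * 3 ^ s
  16*-regroup : ∀ y x → 2 * (2 * (2 * (2 * y))) * x ≡ 16 * (y * x)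
  16*-regroup = solve-∀
  4w<n : 4 * w < n
  4w<n = *-cancelˡ-< 4 (4 * w) n (begin-strict
    4 * (4 * w)   ≡⟨ *-assoc 4 4 w ⟨
    16 * w        ≡⟨ 16*-regroup (2 ^ p) (3 ^ s) ⟨
    2 ^ (4 + p) * 3 ^ s   <⟨ m<3^K ⟩
    3 ^ K         <⟨ 3^K<3n ⟩
    3 * n         ≤⟨ *-monoˡ-≤ n (n≤1+n 3) ⟩
    4 * n         ∎)
    where open ≤-Reasoning

lemma4p4 : (n m r s : ℕ) → 1 ≤ n → n ≤ m → m < 3 ^ ⌈log₃ n ⌉ → 3 ^ ⌈log₃ n ⌉ < 3 * n →
    1 ≤ r → 1 ≤ s → m ≡ 2 ^ r * 3 ^ s →
    ∃[ a ] ∃[ b ] (1 ≤ a × a < b × b ≤ n ×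
      (+ (b ^ 3 + b)) ≡ (+ (a ^ 3 + a)) [mod (+ m) ])
lemma4p4 n m r s _ _ m<3^K 3^K<3n 1≤r _ refl =
  collision-mod-2^r*3^s r s ⌈log₃ n ⌉ 1≤r m<3^K 3^K<3n
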